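{- Consider an execution of the procedure \texttt{search}$(\mathcal{G},T)$ described below. For each tangle $t$ returned by \texttt{extract-tangles}$(Z,\sigma)$ for a region $Z$ of priority $p$ (player $\alpha\equiv p\pmod 2$), at the moment it is found every vertex of $E_T(t)$ lies in a previously computed region of the current decomposition whose priority has the same parity as $p$, i.e. $E_T(t)\subseteq\{v\in\mathrm{dom}(\mathsf{r})\mid \mathsf{r}(v)\equiv p\pmod 2\}$.
   Context: Parity games: $\mathcal{G}=(V_0,V_1,E,\mathsf{pr})$ with finite $V=V_0\cup V_1$ (Even owns $V_0$, Odd owns $V_1$), left-total $E\subseteq V\times V$, $\mathsf{pr}:V\to\{0,\dots,d\}$; plays are infinite paths, won by Even iff the highest priority seen infinitely often is even; $\overline{\alpha}$ is the opponent of $\alpha$; strategies are partial functions $\sigma\subseteq E$ on $V_\alpha$. A $p$-tangle is a nonempty $U\subseteq V$ with $p=\max\mathsf{pr}(U)$ and a witness strategy $\sigma_T(U):U\cap V_\alpha\to U$ of player $\alpha\equiv p\pmod 2$ such that $(U, E\cap(\sigma_T(U)\cup((U\cap V_{\overline\alpha})\times U)))$ is strongly connected and all its cycles have highest priority of parity $\alpha$. For a tangle $t$ of $\alpha$, $E_T(t)=\{v\in V\setminus t\mid \exists u\in t\cap V_{\overline\alpha}, (u,v)\in E\}$ (edges taken in the full game $\mathcal{G}$). For $U\subseteq V$, $\mathcal{G}\cap U$ is the subgame induced by $U$, and for a set of tangles $T$, $T\cap U=\{t\in T\mid t\subseteq U\}$. Tangle attractor: for a game $\mathcal{G}'$ with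 vertices $V'$, a set $T'$ of tangles and $A\subseteq V'$, $\mathit{TAttr}^{\mathcal{G}',T'}_\alpha(A)$ is the least fixed point $Z$ of $Z=A\cup\{v\in V'_\alpha\mid E(v)\cap Z\ne\emptyset\}\cup\{v\in V'_{\overline\alpha}\mid E(v)\subseteq Z\}\cup\{v\in t\mid t\in T',\ \mathsf{pr}(t)\equiv\alpha \pmod 2,\ E_T(t)\neq\emptyset,\ E_T(t)\subseteq Z\}$ (with edges in $\mathcal{G}'$). It also yields a strategy $\sigma$ of $\alpha$: when an $\alpha$-vertex is added because of a successor in $Z$, $\sigma$ picks that successor; $\alpha$-vertices of $A$ get a successor in $Z$ when the backward search finds one; when the vertices of a tangle $t$ are added (tangles processed one at a time), $\sigma$ is extended by $\{(u,v)\in\sigma_T(t)\mid u\notin\mathrm{dom}(\sigma)\}$. \texttt{extract-tangles}$(Z,\sigma)$: compute the greatest $X\subseteq Z$ with $X=Z\cap(\{v\in V_{\overline\alpha}\mid E'(v)\subseteq X\}\cup\{v\in V_\alpha\mid\sigma(v)\in X\})$, where $E'$ are edges of the current subgame $\mathcal{G}'$; return the set of nontrivial bottom strongly connected components of the graph on $X$ whose edges are all $E'$-edges from $\overline\alpha$-vertices and the $\sigma$-edges from $\alpha$-vertices, each with witness strategy $\sigma$ restricted to it. \texttt{search}$(\mathcal{G},T)$: repeat forever: set the region function $\mathsf{r}:=\emptyset$ (a partial map $V\to\{0,\dots,d\}$) and $Y:=\emptyset$; while $V\setminus\mathrm{dom}(\mathsf{r})\ne\emptyset$: let $\mathcal{G}'=\mathcal{G}\cap(V\setminus\mathrm{dom}(\mathsf{r}))$,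 $T'=T\cap(V\setminus\mathrm{dom}(\mathsf{r}))$, $p$ the highest priority in $\mathcal{G}'$, $\alpha=p\bmod 2$; compute $(Z,\sigma)=\mathit{TAttr}^{\mathcal{G}',T'}_\alpha(\{v\in\mathcal{G}'\mid\mathsf{pr}(v)=p\})$ (the region of priority $p$); $A:=$\texttt{extract-tangles}$(Z,\sigma)$; if some $t\in A$ has $E_T(t)=\emptyset$, return $(T\cup Y,t)$; otherwise set $\mathsf{r}(v):=p$ for all $v\in Z$ and $Y:=Y\cup A$. After the while loop, set $T:=T\cup Y$. -}

module Defs where

open import Data.Nat using (ℕ; zero; suc; _≤_; _⊔_; _≟_)
open import Data.Fin using (Fin) renaming (_≟_ to _≟F_)
open import Data.Bool using (Bool; true; false; if_then_else_; _∧_; _∨_)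
open import Data.Maybe using (Maybe; just; nothing; is-nothing)
open import Data.Product using (_×_; _,_; ∃; Σ)
open import Data.Sum using (_⊎_)
open import Data.List using (List; []; _∷_; foldr)
open import Data.Empty using (⊥)
open import Relation.Nullary using (¬_)
open import Relation.Nullary.Decidable using (⌊_⌋)
open import Relation.Binary.PropositionalEquality using (_≡_)
open import Relation.Binary.Construct.Closure.ReflexiveTransitive using (Star)

data Player : Set where
  even odd : Player

opp : Player → Player
opp even = odd
opp odd  = even

parity : ℕ → Player
parity zero    = even
parity (suc k) = opp (parity k)

samePlayer : Player → Player → Bool
samePlayer even even = true
samePlayer odd  odd  = true
samePlayer _    _    = false

record Game : Set where
  field
    n         : ℕ
    owner     : Fin n → Player
    E         : Fin n → Fin n → Bool
    pr        : Fin n → ℕ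
    leftTotal : ∀ v → ∃ λ w → E v w ≡ true

module _ (G : Game) where
  open Game G

  V : Set
  V = Fin n

  VSet : Set
  VSet = V → Bool

  _∈_ : V → VSet → Set
  v ∈ U = U v ≡ true

  _∉_ : V → VSet → Set
  v ∉ U = ¬ (v ∈ U)

  Edge : V → V → Set
  Edge u w = E u w ≡ true

  Strategy : Set
  Strategy = V → Maybe V

  record TangleData : Set where
    constructor mkT
    field
      set   : VSet
      strat : Strategy
  open TangleData public

  TSet : Set₁
  TSet = TangleData → Set

  IsMaxPr : VSet → ℕ → Set
  IsMaxPr U p = (∃ λ v → v ∈ U × pr v ≡ p) × (∀ v → v ∈ U → pr v ≤ p)

  -- Walk R x vs y : a nonempty R-path from x to y, vs = visited vertices
  -- (including x, excluding the final y).  Walk R x vs x is a cycle.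
  data Walk (R : V → V → Set) : V → List V → V → Set where
    one  : ∀ {x y} → R x y → Walk R x (x ∷ []) y
    more : ∀ {x y z vs} → R x y → Walk R y vs z → Walk R x (x ∷ vs) z

  maxPr : List V → ℕ
  maxPr = foldr (λ v m → pr v ⊔ m) 0

  -- edges of (U, E ∩ (σ ∪ ((U ∩ V_ᾱ) × U)))
  TEdge : VSet → Strategy → Player → V → V → Set
  TEdge U σ α u w = u ∈ U × w ∈ U × Edge u w × (owner u ≡ α → σ u ≡ just w)

  IsTangle : TangleData → Set
  IsTangle t = ∃ λ p → IsMaxPr (set t) p ×
    ((∀ u → u ∈ set t → owner u ≡ parity p →
        ∃ λ w → strat t u ≡ just w × w ∈ set t × Edge u w)
    × (∀ u w → u ∈ set t → w ∈ set t → Star (TEdge (set t) (strat t) (parity p)) u w)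
    × (∀ x vs → Walk (TEdge (set t) (strat t) (parity p)) x vs x →
        parity (maxPr vs) ≡ parity p))

  -- E_T(t) for a tangle of player α, edges taken in the full game
  ET : Player → VSet → V → Set
  ET α U v = v ∉ U × ∃ λ u → u ∈ U × owner u ≡ opp α × Edge u v

  ETsub : VSet → Player → VSet → V → Set
  ETsub W α U v = v ∈ W × ET α U v

  TRestr : TSet → VSet → TSet
  TRestr T W t = T t × (∀ v → v ∈ set t → v ∈ W)

  insert : V → VSet → VSet
  insert v Z u = ⌊ u ≟F v ⌋ ∨ Z u

  _∪_ : VSet → VSet → VSet
  (A ∪ B) u = A u ∨ B u

  upd : Strategy → V → Maybe V → Strategy
  upd σ v x u = if ⌊ u ≟F v ⌋ then x else σ u

  orElse : Maybe V → Maybe V → Maybe V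
  orElse (just w) _ = just w
  orElse nothing  m = m

  -- σ ∪ {(u,v) ∈ σ_T(t) | u ∉ dom σ}, with σ_T(t) : t ∩ V_α → t
  extendWith : Strategy → Player → TangleData → Strategy
  extendWith σ α t u =
    orElse (σ u) (if set t u ∧ samePlayer (owner u) α then strat t u else nothing)

  -- Tangle attractor in the subgame G ∩ W with tangle set T (assumed
  -- already restricted to W), player α, target A.

  TangleAttracts : VSet → TSet → Player → VSet → TangleData → Set
  TangleAttracts W T α Z t =
    T t × (∀ v → v ∈ set t → v ∈ W)
    × (∃ λ p → IsMaxPr (set t) p × parity p ≡ α)
    × (∃ λ v → ETsub W α (set t) v)
    × (∀ v → ETsub W α (set t) v → v ∈ Z)

  AttrOp : VSet → TSet → Player → VSet → VSet → V → Set
  AttrOp W T α A Z v =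
    v ∈ W ×
    (v ∈ A
    ⊎ (owner v ≡ α × ∃ λ w → w ∈ W × Edge v w × w ∈ Z)
    ⊎ (owner v ≡ opp α × ∀ w → w ∈ W → Edge v w → w ∈ Z)
    ⊎ (∃ λ t → TangleAttracts W T α Z t × v ∈ set t))

  IsLFP : VSet → TSet → Player → VSet → VSet → Set
  IsLFP W T α A Z =
    (∀ v → v ∈ Z → AttrOp W T α A Z v)
    × (∀ v → AttrOp W T α A Z v → v ∈ Z)
    × (∀ (Z' : VSet) → (∀ v → v ∈ Z' → AttrOp W T α A Z' v)
                     → (∀ v → AttrOp W T α A Z' v → v ∈ Z')
                     → ∀ v → v ∈ Z → v ∈ Z')

  -- the possible (nondeterministic) runs of the attractor computation,
  -- building Z and the strategy σ step by step
  data AttrRun (W : VSet) (T : TSet) (α : Player) (A : VSet) : VSet → Strategy → Set where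
    start : AttrRun W T α A A (λ _ → nothing)
    addα  : ∀ {Z σ v w} → AttrRun W T α A Z σ → v ∈ W → v ∉ Z → owner v ≡ α →
            w ∈ W → Edge v w → w ∈ Z → AttrRun W T α A (insert v Z) (upd σ v (just w))
    addᾱ  : ∀ {Z σ v} → AttrRun W T α A Z σ → v ∈ W → v ∉ Z → owner v ≡ opp α →
            (∀ w → w ∈ W → Edge v w → w ∈ Z) → AttrRun W T α A (insert v Z) σ
    addT  : ∀ {Z σ t} → AttrRun W T α A Z σ → TangleAttracts W T α Z t →
            (∃ λ v → v ∈ set t × v ∉ Z) → AttrRun W T α A (Z ∪ set t) (extendWith σ α t)
    addA  : ∀ {Z σ v w} → AttrRun W T α A Z σ → v ∈ A → owner v ≡ α → σ v ≡ nothing →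
            w ∈ W → Edge v w → w ∈ Z → AttrRun W T α A Z (upd σ v (just w))

  -- (Z, σ) is a possible result of TAttr^{G∩W,T}_α(A)
  AttrResult : VSet → TSet → Player → VSet → VSet → Strategy → Set
  AttrResult W T α A Z σ =
    AttrRun W T α A Z σ × IsLFP W T α A Z
    × (∀ v → v ∈ A → owner v ≡ α → (∃ λ w → w ∈ W × Edge v w × w ∈ Z) →
         ∃ λ w → σ v ≡ just w)

  -- extract-tangles(Z, σ) in the subgame G ∩ W for player α

  ExtOp : VSet → Player → VSet → Strategy → VSet → V → Set
  ExtOp W α Z σ X v =
    v ∈ Z ×
    ((owner v ≡ opp α × ∀ w → w ∈ W → Edge v w → w ∈ X)
    ⊎ (owner v ≡ α × ∃ λ w → σ v ≡ just w × w ∈ X))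

  IsGFP : VSet → Player → VSet → Strategy → VSet → Set
  IsGFP W α Z σ X =
    (∀ v → v ∈ X → ExtOp W α Z σ X v)
    × (∀ v → ExtOp W α Z σ X v → v ∈ X)
    × (∀ (X' : VSet) → (∀ v → v ∈ X' → ExtOp W α Z σ X' v)
                     → (∀ v → ExtOp W α Z σ X' v → v ∈ X')
                     → ∀ v → v ∈ X' → v ∈ X)

  XEdge : VSet → Player → Strategy → VSet → V → V → Set
  XEdge W α σ X u w =
    u ∈ X × w ∈ X ×
    ((owner u ≡ opp α × w ∈ W × Edge u w) ⊎ (owner u ≡ α × σ u ≡ just w))

  IsNontrivialBSCC : VSet → Player → Strategy → VSet → VSet → Set
  IsNontrivialBSCC W α σ X C =
    (∀ v → v ∈ C → v ∈ X)
    × (∀ u w → u ∈ C → w ∈ C → Star (XEdge W α σ X) u w)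
    × (∀ u w → u ∈ C → Star (XEdge W α σ X) u w → Star (XEdge W α σ X) w u → w ∈ C)
    × (∀ u w → u ∈ C → XEdge W α σ X u w → w ∈ C)
    × (∃ λ u → ∃ λ w → u ∈ C × w ∈ C × XEdge W α σ X u w)

  restrict : Strategy → VSet → Strategy
  restrict σ C v = if C v then σ v else nothing

  Extracted : VSet → Player → VSet → Strategy → TangleData → Set
  Extracted W α Z σ t =
    ∃ λ X → IsGFP W α Z σ X × IsNontrivialBSCC W α σ X (set t)
          × (∀ v → strat t v ≡ restrict σ (set t) v)

  -- search(G, T₀): reachable states (T, r, Y) at the head of the while loop

  Region : Set
  Region = V → Maybe ℕ

  Free : Region → VSet
  Free r v = is-nothing (r v)

  top : VSet → ℕ → VSet
  top W p v = W v ∧ ⌊ pr v ≟ p ⌋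

  assign : Region → VSet → ℕ → Region
  assign r Z p v = if Z v then just p else r v

  data Reach (T₀ : TSet) : TSet → Region → TSet → Set₁ where
    init  : Reach T₀ T₀ (λ _ → nothing) (λ _ → ⊥)
    step  : ∀ {T r Y p Z σ} → Reach T₀ T r Y →
            IsMaxPr (Free r) p →
            AttrResult (Free r) (TRestr T (Free r)) (parity p) (top (Free r) p) Z σ →
            (∀ t → Extracted (Free r) (parity p) Z σ t → ∃ λ v → ET (parity p) (set t) v) →
            Reach T₀ T (assign r Z p) (λ t → Y t ⊎ Extracted (Free r) (parity p) Z σ t)
    outer : ∀ {T r Y} → Reach T₀ T r Y → (∀ v → ¬ (r v ≡ nothing)) →
            Reach T₀ (λ t → T t ⊎ Y t) (λ _ → nothing) (λ _ → ⊥)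

-- Every region computed by search is an attractor in the subgame that was still free at the
-- time, so no free vertex of the region's player has an edge into it; since the free part
-- only shrinks, this persists through the whole decomposition. Now let u be an opponent
-- vertex of an extracted tangle t with an edge to v ∉ t. As t is a bottom SCC of a graph
-- containing all free edges of opponent vertices, v cannot be free; so v lies in a region
-- of some priority q, and the invariant for u (which is free and belongs to the opponent of
-- parity p) forces q ≡ p (mod 2).
module Submission where

open import Defs
open import Data.Nat using (ℕ)
open import Data.Bool using (true; false)
open import Data.Maybe using (Maybe; just; nothing; is-nothing)
open import Data.Product using (_×_; ∃; _,_; proj₁)
open import Data.Sum using (_⊎_; inj₁; inj₂)
open import Data.Empty using (⊥-elim)
open import Relation.Nullary using (¬_)
open import Relation.Binary.PropositionalEquality using (_≡_; _≢_; refl; sym; trans)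

≢opp⇒≡ : ∀ {α β} → β ≢ opp α → β ≡ α
≢opp⇒≡ {even} {even} _ = refl
≢opp⇒≡ {even} {odd}  β≢ = ⊥-elim (β≢ refl)
≢opp⇒≡ {odd}  {even} β≢ = ⊥-elim (β≢ refl)
≢opp⇒≡ {odd}  {odd}  _ = refl

opp≢ : ∀ α → opp α ≢ α
opp≢ even ()
opp≢ odd  ()

is-nothing⇒≡nothing : ∀ {A : Set} {m : Maybe A} → is-nothing m ≡ true → m ≡ nothing
is-nothing⇒≡nothing {m = nothing} _ = refl

≡nothing⇒is-nothing : ∀ {A : Set} {m : Maybe A} → m ≡ nothing → is-nothing m ≡ true
≡nothing⇒is-nothing refl = refl

module _ (G : Game) where
  open Game G

  ClosedRegions : Region G → Set
  ClosedRegions r = ∀ {u v q} → r u ≡ nothing → r v ≡ just q → owner u ≡ parity q → ¬ Edge G u v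

  lfp-pulls-α-predecessors : ∀ {W T α A Z u w} → IsLFP G W T α A Z →
    _∈_ G u W → owner u ≡ α → Edge G u w → _∈_ G w Z → _∈_ G u Z
  lfp-pulls-α-predecessors {w = w} (lfp-sound , lfp-closed , _) u∈W owner≡α e w∈Z =
    lfp-closed _ (u∈W , inj₂ (inj₁ (owner≡α , w , proj₁ (lfp-sound w w∈Z) , e , w∈Z)))

  lfp⊆W : ∀ {W T α A Z u} → IsLFP G W T α A Z → _∈_ G u Z → _∈_ G u W
  lfp⊆W (lfp-sound , _) u∈Z = proj₁ (lfp-sound _ u∈Z)

  assign-nothing : ∀ {r Z p u} → assign G r Z p u ≡ nothing → Z u ≡ false × r u ≡ nothing
  assign-nothing {Z = Z} {u = u} eq with Z u
  ... | false = refl , eq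

  assign-just : ∀ {r Z p v q} → assign G r Z p v ≡ just q → (Z v ≡ true × q ≡ p) ⊎ r v ≡ just q
  assign-just {Z = Z} {v = v} eq with Z v
  assign-just refl | true  = inj₁ (refl , refl)
  ...              | false = inj₂ eq

  reach⇒closedRegions : ∀ {T₀ T r Y} → Reach G T₀ T r Y → ClosedRegions r
  reach⇒closedRegions init _ ()
  reach⇒closedRegions (outer _ _) _ ()
  reach⇒closedRegions (step {r = r} {p = p} {Z = Z} prev _ (_ , lfp , _) _) ru≡nothing rv≡just owner≡ e
    with assign-nothing {r} {Z} {p} ru≡nothing | assign-just {r} {Z} {p} rv≡just
  ... | _ , ru | inj₂ rv = reach⇒closedRegions prev ru rv owner≡ e
  ... | u∉Z , ru | inj₁ (v∈Z , refl)
    with trans (sym u∉Z) (lfp-pulls-α-predecessors lfp (≡nothing⇒is-nothing ru) owner≡ e v∈Z)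
  ... | ()

  extracted⊆Z : ∀ {W α Z σ t u} → Extracted G W α Z σ t → _∈_ G u (TangleData.set t) → _∈_ G u Z
  extracted⊆Z (_ , (gfp-sound , _) , (t⊆X , _) , _) u∈t = proj₁ (gfp-sound _ (t⊆X _ u∈t))

  extracted-closed-under-opponent-edges : ∀ {W α Z σ t u v} → Extracted G W α Z σ t →
    _∈_ G u (TangleData.set t) → owner u ≡ opp α → _∈_ G v W → Edge G u v → _∈_ G v (TangleData.set t)
  extracted-closed-under-opponent-edges {α = α} {u = u} {v = v}
    (_ , (gfp-sound , _) , (t⊆X , _ , _ , t-closed , _) , _) u∈t owner≡ v∈W e
    with gfp-sound u (t⊆X u u∈t)
  ... | _ , inj₁ (_ , succ⊆X) = t-closed u v u∈t (t⊆X u u∈t , succ⊆X v v∈W e , inj₁ (owner≡ , v∈W , e))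
  ... | _ , inj₂ (owner≡α , _) = ⊥-elim (opp≢ α (trans (sym owner≡) owner≡α))

lemma4 : (G : Game) (T₀ : TSet G) → (∀ t → T₀ t → IsTangle G t) →
         ∀ {T r Y} → Reach G T₀ T r Y →
         ∀ (p : ℕ) Z σ → IsMaxPr G (Free G r) p →
         AttrResult G (Free G r) (TRestr G T (Free G r)) (parity p) (top G (Free G r) p) Z σ →
         ∀ t → Extracted G (Free G r) (parity p) Z σ t →
         ∀ v → ET G (parity p) (TangleData.set t) v →
         ∃ λ q → r v ≡ just q × parity q ≡ parity p
lemma4 G _ _ {r = r} reach p _ _ _ (_ , lfp , _) t extracted v (v∉t , u , u∈t , owner≡ , e)
  with r v in rv
... | nothing = ⊥-elim (v∉t (extracted-closed-under-opponent-edges G extracted u∈t owner≡ v-free e))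
  where
  v-free : _∈_ G v (Free G r)
  v-free = ≡nothing⇒is-nothing rv
... | just q = q , refl , ≢opp⇒≡ λ q≡opp →
  reach⇒closedRegions G reach u-free rv (trans owner≡ (sym q≡opp)) e
  where
  u-free : r u ≡ nothing
  u-free = is-nothing⇒≡nothing (lfp⊆W G lfp (extracted⊆Z G extracted u∈t))
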